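{- Let $L$ be an $n\times n$ alternating sign hypermatrix Latin-like square, and let $v$ be any row or any column of $L$ (viewed as a vector of length $n$). Then $v\preceq(n,n-1,\dots,2,1)$.
   Context: An $n\times n\times n$ alternating sign hypermatrix (ASHM) is a $(0,1,-1)$-array $A=[a_{ijk}]$ such that along every line (fixing two of the three indices and letting the third range over $1,\dots,n$) the nonzero entries alternate in sign, starting and ending with $+1$. Its planes are $P_k(A)=[a_{ijk}]_{1\le i,j\le n}$. The alternating sign hypermatrix Latin-like square (ASHL) of $A$ is the $n\times n$ array $L(A)=\sum_{k=1}^n k\,P_k(A)$. A vector $x$ is majorized by $y$, written $x\preceq y$, if for every $k=1,\dots,n$, $\sum_{i=1}^k x^{\downarrow}_i\le\sum_{i=1}^k y^{\downarrow}_i$, with equality for $k=n$, where $x^{\downarrow}_i$ is the $i$-th largest entry of $x$. -}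

module Defs where

open import Data.Nat as ℕ using (ℕ; suc)
open import Data.Integer as ℤ using (ℤ; +_; -[1+_]; _*_; _+_; _≤_)
open import Data.Integer.Properties using (≤-decTotalOrder)
open import Data.Fin using (Fin; toℕ)
open import Data.List using (List; []; _∷_; filter; take; reverse; map; foldr; allFin; length)
open import Data.Product using (_×_)
open import Data.Sum using (_⊎_)
open import Relation.Binary.PropositionalEquality using (_≡_; _≢_)
open import Relation.Nullary using (¬_)
open import Relation.Nullary.Decidable using (¬?)
open import Data.List.Sort ≤-decTotalOrder using (sort)

sumℤ : List ℤ → ℤ
sumℤ = foldr _+_ (+ 0)

lineList : ∀ {n} → (Fin n → ℤ) → List ℤ
lineList f = map f (allFin _)

nonzeros : List ℤ → List ℤ
nonzeros = filter (λ x → ¬? (x ℤ.≟ + 0))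

data Alternating : List ℤ → Set where
  alt-one  : Alternating (+ 1 ∷ [])
  alt-cons : ∀ {xs} → Alternating xs → Alternating (+ 1 ∷ -[1+ 0 ] ∷ xs)

IsSign : ℤ → Set
IsSign x = (x ≡ + 0) ⊎ (x ≡ + 1) ⊎ (x ≡ -[1+ 0 ])

AltLine : ∀ {n} → (Fin n → ℤ) → Set
AltLine f = Alternating (nonzeros (lineList f))

Hyper : ℕ → Set
Hyper n = Fin n → Fin n → Fin n → ℤ

record IsASHM {n : ℕ} (A : Hyper n) : Set where
  field
    entries : ∀ i j k → IsSign (A i j k)
    line-k  : ∀ i j → AltLine (λ k → A i j k)
    line-j  : ∀ i k → AltLine (λ j → A i j k)
    line-i  : ∀ j k → AltLine (λ i → A i j k)

-- L(A) = Σ_k k P_k(A); Fin index k corresponds to the plane number toℕ k + 1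
ASHL : ∀ {n} → Hyper n → Fin n → Fin n → ℤ
ASHL {n} A i j = sumℤ (map (λ k → + (suc (toℕ k)) * A i j k) (allFin n))

decreasing : List ℤ → List ℤ
decreasing xs = reverse (sort xs)

topSum : ℕ → List ℤ → ℤ
topSum k xs = sumℤ (take k (decreasing xs))

_⪯_ : ∀ {n} → (Fin n → ℤ) → (Fin n → ℤ) → Set
_⪯_ {n} x y =
  (∀ (k : Fin n) → topSum (suc (toℕ k)) (lineList x) ≤ topSum (suc (toℕ k)) (lineList y))
  × (topSum n (lineList x) ≡ topSum n (lineList y))

staircase : (n : ℕ) → Fin n → ℤ
staircase n i = + (n ℕ.∸ toℕ i)

-- Fix a row (or column) of L.  The plane of A through it is an alternating sign
-- matrix B, and the row (column) of L is the vector of weighted row sums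
-- v_j = Σ_k k·B_jk.  Writing k = #{t ≤ k} gives v_j = Σ_t r_jt, where r_jt is the
-- sum of row j of B from position t on.  Alternation of the rows makes every r_jt
-- equal to 0 or 1, and every column of B sums to 1, so column t of r sums to
-- n + 1 − t.  Hence any m rows of r contribute at most min(m, n + 1 − t) to
-- column t, and Σ_t min(m, n + 1 − t) is exactly the sum of the m largest entries
-- of (n, n − 1, …, 1); for m = n both totals are Σ_t (n + 1 − t).
module Submission where

open import Defs
open import Data.Bool using (true; false)
open import Data.Fin using (Fin; zero; suc; toℕ)
open import Data.Integer as ℤ using (ℤ; +_; -[1+_]; _+_; _*_; _≤_; +≤+)
import Data.Integer.Properties as ℤP
open import Data.List using (List; []; _∷_; map; take; drop; reverse; filter; tabulate; allFin; length; applyUpTo; applyDownFrom)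
import Data.List.Properties as LP
open import Data.List.Relation.Binary.Permutation.Propositional using (_↭_; ↭-sym; ↭-trans; ↭⇒↭ₛ)
import Data.List.Relation.Binary.Permutation.Propositional.Properties as PermP
import Data.List.Relation.Binary.Permutation.Setoid.Properties as PermSetoidP
open import Data.List.Relation.Binary.Pointwise using (Pointwise-≡⇒≡)
open import Data.List.Relation.Unary.All as All using (All; []; _∷_)
import Data.List.Relation.Unary.All.Properties as AllP
open import Data.List.Relation.Unary.Sorted.TotalOrder ℤP.≤-totalOrder using (Sorted)
import Data.List.Relation.Unary.Sorted.TotalOrder.Properties as SortedP
open import Data.List.Sort ℤP.≤-decTotalOrder using (sort; sort-↭; sort-↗)
open import Data.Nat as ℕ using (ℕ; zero; suc; _⊓_; _∸_)
import Data.Nat.Properties as ℕP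
open import Data.Product using (_×_; _,_; ∃; proj₁; proj₂)
open import Function using (_∘_)
open import Level using (0ℓ)
open import Relation.Binary.PropositionalEquality
open import Relation.Nullary using (yes; no; does; ¬?)
open import Relation.Unary using (Pred; Decidable)
open import Algebra.Properties.CommutativeMonoid.Sum ℤP.+-0-commutativeMonoid
  using (sum; sum-syntax; sum-cong-≗; ∑-distrib-+; ∑-comm; sum-replicate-zero)
open import Algebra.Properties.CommutativeSemigroup ℕP.+-commutativeSemigroup
  using (x∙yz≈y∙xz)

sumℤ-tabulate : ∀ {n} (f : Fin n → ℤ) → sumℤ (tabulate f) ≡ sum f
sumℤ-tabulate {zero}  f = refl
sumℤ-tabulate {suc n} f = cong (_+_ (f zero)) (sumℤ-tabulate (f ∘ suc))

sumℤ-lineList : ∀ {n} (f : Fin n → ℤ) → sumℤ (lineList f) ≡ sum f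
sumℤ-lineList f = trans (cong sumℤ (LP.map-tabulate (λ i → i) f)) (sumℤ-tabulate f)

sumℤ-↭ : ∀ {xs ys} → xs ↭ ys → sumℤ xs ≡ sumℤ ys
sumℤ-↭ xs↭ys = PermSetoidP.foldr-commMonoid (setoid ℤ) ℤP.+-0-isCommutativeMonoid (↭⇒↭ₛ xs↭ys)

∑-mono-≤ : ∀ {n} {f g : Fin n → ℤ} → (∀ i → f i ≤ g i) → sum f ≤ sum g
∑-mono-≤ {zero}  f≤g = ℤP.≤-refl
∑-mono-≤ {suc n} f≤g = ℤP.+-mono-≤ (f≤g zero) (∑-mono-≤ (f≤g ∘ suc))

sumℤ-map-∑ : ∀ {A : Set} {n} (xs : List A) (F : A → Fin n → ℤ) →
             sumℤ (map (λ x → ∑[ t < n ] F x t) xs) ≡ ∑[ t < n ] sumℤ (map (λ x → F x t) xs)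
sumℤ-map-∑ {n = n} []       F = sym (sum-replicate-zero n)
sumℤ-map-∑         (x ∷ xs) F =
  trans (cong (_+_ (sum (F x))) (sumℤ-map-∑ xs F)) (sym (∑-distrib-+ (F x) _))

sumℤ-take-≤ : ∀ m {xs} → All (_≤ + 1) xs → sumℤ (take m xs) ≤ + m
sumℤ-take-≤ zero    _            = ℤP.≤-refl
sumℤ-take-≤ (suc m) []           = +≤+ ℕ.z≤n
sumℤ-take-≤ (suc m) (x≤1 ∷ xs≤1) = ℤP.+-mono-≤ x≤1 (sumℤ-take-≤ m xs≤1)

sumℤ-nonneg : ∀ {xs} → All (+ 0 ≤_) xs → + 0 ≤ sumℤ xs
sumℤ-nonneg []           = ℤP.≤-refl
sumℤ-nonneg (0≤x ∷ 0≤xs) = ℤP.+-mono-≤ 0≤x (sumℤ-nonneg 0≤xs)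

sumℤ-take-≤-sumℤ : ∀ m {xs} → All (+ 0 ≤_) xs → sumℤ (take m xs) ≤ sumℤ xs
sumℤ-take-≤-sumℤ zero    0≤xs                = sumℤ-nonneg 0≤xs
sumℤ-take-≤-sumℤ (suc m) []                  = ℤP.≤-refl
sumℤ-take-≤-sumℤ (suc m) {x ∷ _} (_ ∷ 0≤xs) = ℤP.+-monoʳ-≤ x (sumℤ-take-≤-sumℤ m 0≤xs)

IsBit : ℤ → Set
IsBit x = + 0 ≤ x × x ≤ + 1

sumℤ-take-≤-⊓ : ∀ m {xs} c → All IsBit xs → sumℤ xs ≡ + c → sumℤ (take m xs) ≤ + (m ⊓ c)
sumℤ-take-≤-⊓ m c bits total = ℤP.⊓-glb
  (sumℤ-take-≤ m (All.map proj₂ bits))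
  (ℤP.≤-trans (sumℤ-take-≤-sumℤ m (All.map proj₁ bits)) (ℤP.≤-reflexive total))

decreasing-↭ : ∀ xs → decreasing xs ↭ xs
decreasing-↭ xs = ↭-trans (PermP.↭-reverse (sort xs)) (sort-↭ xs)

decreasing-reverse : ∀ {xs} → Sorted xs → decreasing (reverse xs) ≡ reverse xs
decreasing-reverse {xs} xs↗ = cong reverse (Pointwise-≡⇒≡
  (SortedP.↗↭↗⇒≋ ℤP.≤-totalOrder (sort-↗ (reverse xs)) xs↗
    (↭⇒↭ₛ (↭-trans (sort-↭ (reverse xs)) (PermP.↭-reverse xs)))))

topSum-total : ∀ {n} (x : Fin n → ℤ) → topSum n (lineList x) ≡ sum x
topSum-total {n} x = begin
  sumℤ (take n (decreasing (lineList x))) ≡⟨ cong sumℤ (LP.take-all n _ (ℕP.≤-reflexive length-decreasing)) ⟩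
  sumℤ (decreasing (lineList x))          ≡⟨ sumℤ-↭ (decreasing-↭ (lineList x)) ⟩
  sumℤ (lineList x)                       ≡⟨ sumℤ-lineList x ⟩
  sum x                                   ∎
  where
  open ≡-Reasoning
  length-decreasing : length (decreasing (lineList x)) ≡ n
  length-decreasing = trans (PermP.↭-length (decreasing-↭ (lineList x)))
                            (trans (LP.length-map x (allFin n)) (LP.length-tabulate (λ i → i)))

⪯-respˡ-≗ : ∀ {n} {x y z : Fin n → ℤ} → (∀ i → x i ≡ y i) → y ⪯ z → x ⪯ z
⪯-respˡ-≗ {n} {x} {y} x≗y (y≤z , y≡z) =
  (λ k → subst (λ l → topSum (suc (toℕ k)) l ≤ _) (sym lines≡) (y≤z k)) ,
  subst (λ l → topSum n l ≡ _) (sym lines≡) y≡z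
  where
  lines≡ : lineList x ≡ lineList y
  lines≡ = LP.map-cong x≗y (allFin n)

cappedSum : ℕ → ℕ → ℕ
cappedSum m zero    = 0
cappedSum m (suc n) = m ⊓ suc n ℕ.+ cappedSum m n

cappedSum-zeroˡ : ∀ n → cappedSum 0 n ≡ 0
cappedSum-zeroˡ zero    = refl
cappedSum-zeroˡ (suc n) = cappedSum-zeroˡ n

cappedSum-suc : ∀ m n → cappedSum (suc m) (suc n) ≡ suc n ℕ.+ cappedSum m n
cappedSum-suc m zero    = cong suc (trans (ℕP.+-identityʳ (m ⊓ 0)) (ℕP.⊓-zeroʳ m))
cappedSum-suc m (suc n) = cong suc (begin
  m ⊓ suc n ℕ.+ cappedSum (suc m) (suc n) ≡⟨ cong (m ⊓ suc n ℕ.+_) (cappedSum-suc m n) ⟩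
  m ⊓ suc n ℕ.+ (suc n ℕ.+ cappedSum m n) ≡⟨ x∙yz≈y∙xz (m ⊓ suc n) (suc n) (cappedSum m n) ⟩
  suc n ℕ.+ (m ⊓ suc n ℕ.+ cappedSum m n) ∎)
  where open ≡-Reasoning

cappedSum-∑ : ∀ m n → ∑[ t < n ] (+ (m ⊓ (n ∸ toℕ t))) ≡ + cappedSum m n
cappedSum-∑ m zero    = refl
cappedSum-∑ m (suc n) = cong (_+_ (+ (m ⊓ suc n))) (cappedSum-∑ m n)

tabulate-staircase : ∀ n → tabulate (staircase n) ≡ applyDownFrom (λ i → + suc i) n
tabulate-staircase zero    = refl
tabulate-staircase (suc n) = cong (_∷_ (+ suc n)) (tabulate-staircase n)

sumℤ-take-applyDownFrom : ∀ m n → sumℤ (take m (applyDownFrom (λ i → + suc i) n)) ≡ + cappedSum m n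
sumℤ-take-applyDownFrom zero    n       = sym (cong +_ (cappedSum-zeroˡ n))
sumℤ-take-applyDownFrom (suc m) zero    = refl
sumℤ-take-applyDownFrom (suc m) (suc n) =
  trans (cong (_+_ (+ suc n)) (sumℤ-take-applyDownFrom m n)) (sym (cong +_ (cappedSum-suc m n)))

topSum-staircase : ∀ m n → topSum m (lineList (staircase n)) ≡ + cappedSum m n
topSum-staircase m n = begin
  sumℤ (take m (decreasing (lineList (staircase n))))  ≡⟨ cong (λ xs → sumℤ (take m (decreasing xs))) staircase-reversed ⟩
  sumℤ (take m (decreasing (reverse ascending)))       ≡⟨ cong (sumℤ ∘ take m) (decreasing-reverse ascending↗) ⟩
  sumℤ (take m (reverse ascending))                    ≡⟨ cong (sumℤ ∘ take m) (LP.reverse-applyUpTo _ n) ⟩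
  sumℤ (take m (applyDownFrom (λ i → + suc i) n))      ≡⟨ sumℤ-take-applyDownFrom m n ⟩
  + cappedSum m n                                      ∎
  where
  open ≡-Reasoning
  ascending : List ℤ
  ascending = applyUpTo (λ i → + suc i) n
  ascending↗ : Sorted ascending
  ascending↗ = SortedP.applyUpTo⁺₂ ℤP.≤-totalOrder _ n (λ i → +≤+ (ℕP.n≤1+n (suc i)))
  staircase-reversed : lineList (staircase n) ≡ reverse ascending
  staircase-reversed = begin
    lineList (staircase n)                  ≡⟨ LP.map-tabulate (λ i → i) (staircase n) ⟩
    tabulate (staircase n)                  ≡⟨ tabulate-staircase n ⟩
    applyDownFrom (λ i → + suc i) n         ≡⟨ LP.reverse-applyUpTo _ n ⟨
    reverse ascending                       ∎

filter-drop : ∀ {A : Set} {P : Pred A 0ℓ} (P? : Decidable P) t (xs : List A) →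
              ∃ λ s → filter P? (drop t xs) ≡ drop s (filter P? xs)
filter-drop P? zero    xs       = 0 , refl
filter-drop P? (suc t) []       = 0 , refl
filter-drop P? (suc t) (x ∷ xs) with filter-drop P? t xs | does (P? x)
... | s , eq | true  = suc s , eq
... | s , eq | false = s , eq

sumℤ-nonzeros : ∀ xs → sumℤ (nonzeros xs) ≡ sumℤ xs
sumℤ-nonzeros []       = refl
sumℤ-nonzeros (x ∷ xs) with x ℤ.≟ + 0
... | yes refl = trans (sumℤ-nonzeros xs) (sym (ℤP.+-identityˡ (sumℤ xs)))
... | no  _    = cong (_+_ x) (sumℤ-nonzeros xs)

Alternating-sum : ∀ {xs} → Alternating xs → sumℤ xs ≡ + 1
Alternating-sum alt-one        = refl
Alternating-sum (alt-cons alt) = cong (λ s → + 1 + (-[1+ 0 ] + s)) (Alternating-sum alt)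

Alternating-suffix-bit : ∀ {xs} → Alternating xs → ∀ s → IsBit (sumℤ (drop s xs))
Alternating-suffix-bit alt-one        zero          = +≤+ ℕ.z≤n , ℤP.≤-refl
Alternating-suffix-bit alt-one        (suc s)       rewrite LP.drop-[] {A = ℤ} s = ℤP.≤-refl , +≤+ ℕ.z≤n
Alternating-suffix-bit (alt-cons alt) zero          rewrite Alternating-sum alt = +≤+ ℕ.z≤n , ℤP.≤-refl
Alternating-suffix-bit (alt-cons alt) (suc zero)    rewrite Alternating-sum alt = ℤP.≤-refl , +≤+ ℕ.z≤n
Alternating-suffix-bit (alt-cons alt) (suc (suc s)) = Alternating-suffix-bit alt s

suffixSum : ∀ {n} → ℕ → (Fin n → ℤ) → ℤ
suffixSum t a = sumℤ (drop t (tabulate a))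

AltLine-sum : ∀ {n} {a : Fin n → ℤ} → AltLine a → sum a ≡ + 1
AltLine-sum {a = a} alt = begin
  sum a                         ≡⟨ sumℤ-lineList a ⟨
  sumℤ (lineList a)             ≡⟨ sumℤ-nonzeros (lineList a) ⟨
  sumℤ (nonzeros (lineList a))  ≡⟨ Alternating-sum alt ⟩
  + 1                           ∎
  where open ≡-Reasoning

AltLine-suffixSum-bit : ∀ {n} {a : Fin n → ℤ} → AltLine a → ∀ t → IsBit (suffixSum t a)
AltLine-suffixSum-bit {a = a} alt t
  with s , eq ← filter-drop (λ x → ¬? (x ℤ.≟ + 0)) t (tabulate a) =
  subst IsBit (trans (cong sumℤ (sym eq)) (sumℤ-nonzeros (drop t (tabulate a))))
    (Alternating-suffix-bit (subst (Alternating ∘ nonzeros) (LP.map-tabulate (λ i → i) a) alt) s)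

weightedSum≡∑suffixSum : ∀ {n} (a : Fin n → ℤ) →
  ∑[ k < n ] (+ suc (toℕ k) * a k) ≡ ∑[ t < n ] suffixSum (toℕ t) a
weightedSum≡∑suffixSum {zero}  a = refl
weightedSum≡∑suffixSum {suc n} a = begin
  + 1 * a zero + ∑[ k < n ] (+ suc (suc (toℕ k)) * a (suc k))
    ≡⟨ cong₂ _+_ (ℤP.*-identityˡ (a zero)) (sum-cong-≗ split) ⟩
  a zero + ∑[ k < n ] (a (suc k) + + suc (toℕ k) * a (suc k))
    ≡⟨ cong (_+_ (a zero)) (∑-distrib-+ (a ∘ suc) _) ⟩
  a zero + (sum (a ∘ suc) + ∑[ k < n ] (+ suc (toℕ k) * a (suc k)))
    ≡⟨ ℤP.+-assoc (a zero) _ _ ⟨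
  sum a + ∑[ k < n ] (+ suc (toℕ k) * a (suc k))
    ≡⟨ cong₂ _+_ (sym (sumℤ-tabulate a)) (weightedSum≡∑suffixSum (a ∘ suc)) ⟩
  suffixSum 0 a + ∑[ t < n ] suffixSum (toℕ t) (a ∘ suc) ∎
  where
  open ≡-Reasoning
  split : ∀ k → + suc (suc (toℕ k)) * a (suc k) ≡ a (suc k) + + suc (toℕ k) * a (suc k)
  split k = trans (ℤP.*-distribʳ-+ (a (suc k)) (+ 1) (+ suc (toℕ k)))
                  (cong (_+ + suc (toℕ k) * a (suc k)) (ℤP.*-identityˡ (a (suc k))))

suffixSum-∑ : ∀ {m n} t (F : Fin m → Fin n → ℤ) →
              suffixSum t (λ k → ∑[ j < m ] F j k) ≡ ∑[ j < m ] suffixSum t (F j)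
suffixSum-∑ {m} {n} zero F = begin
  sumℤ (tabulate (λ k → ∑[ j < m ] F j k)) ≡⟨ sumℤ-tabulate (λ k → ∑[ j < m ] F j k) ⟩
  ∑[ k < n ] ∑[ j < m ] F j k              ≡⟨ ∑-comm (λ k j → F j k) ⟩
  ∑[ j < m ] sum (F j)                     ≡⟨ sum-cong-≗ (sumℤ-tabulate ∘ F) ⟨
  ∑[ j < m ] sumℤ (tabulate (F j))         ∎
  where open ≡-Reasoning
suffixSum-∑ {m} {zero}  (suc t) F = sym (sum-replicate-zero m)
suffixSum-∑ {m} {suc n} (suc t) F = suffixSum-∑ t (λ j → F j ∘ suc)

suffixSum-cong : ∀ {n} t {a b : Fin n → ℤ} → (∀ k → a k ≡ b k) → suffixSum t a ≡ suffixSum t b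
suffixSum-cong t a≗b = cong (sumℤ ∘ drop t) (LP.tabulate-cong a≗b)

suffixSum-ones : ∀ {n} t → suffixSum {n} t (λ _ → + 1) ≡ + (n ∸ t)
suffixSum-ones {zero}  t       = trans (cong sumℤ (LP.drop-[] t)) (cong +_ (sym (ℕP.0∸n≡0 t)))
suffixSum-ones {suc n} zero    = cong (_+_ (+ 1)) (suffixSum-ones {n} zero)
suffixSum-ones {suc n} (suc t) = suffixSum-ones {n} t

module _ {n} (r : Fin n → Fin n → ℤ) (bit : ∀ j t → IsBit (r j t))
         (colSum : ∀ t → ∑[ j < n ] r j t ≡ + (n ∸ toℕ t)) where

  rowSums : Fin n → ℤ
  rowSums j = sum (r j)

  private
    sorting : ∃ λ Z → decreasing (lineList rowSums) ≡ map rowSums Z × allFin n ↭ Z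
    sorting = PermP.↭-map-inv rowSums (↭-sym (decreasing-↭ (lineList rowSums)))

    Z : List (Fin n)
    Z = proj₁ sorting

    column-bound : ∀ m t → sumℤ (map (λ j → r j t) (take m Z)) ≤ + (m ⊓ (n ∸ toℕ t))
    column-bound m t = subst (_≤ _) (cong sumℤ (LP.take-map m Z))
      (sumℤ-take-≤-⊓ m _ (AllP.map⁺ (All.universal (λ j → bit j t) Z)) (begin
        sumℤ (map f Z)         ≡⟨ sumℤ-↭ (PermP.map⁺ f (proj₂ (proj₂ sorting))) ⟨
        sumℤ (lineList f)      ≡⟨ sumℤ-lineList f ⟩
        sum f                  ≡⟨ colSum t ⟩
        + (n ∸ toℕ t)          ∎))
      where
      open ≡-Reasoning
      f : Fin n → ℤ
      f j = r j t

  topSum-rowSums-≤ : ∀ m → topSum m (lineList rowSums) ≤ + cappedSum m n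
  topSum-rowSums-≤ m = begin
    sumℤ (take m (decreasing (lineList rowSums)))          ≡⟨ cong (sumℤ ∘ take m) (proj₁ (proj₂ sorting)) ⟩
    sumℤ (take m (map rowSums Z))                           ≡⟨ cong sumℤ (LP.take-map m Z) ⟩
    sumℤ (map rowSums (take m Z))                           ≡⟨ sumℤ-map-∑ (take m Z) r ⟩
    ∑[ t < n ] sumℤ (map (λ j → r j t) (take m Z))          ≤⟨ ∑-mono-≤ (column-bound m) ⟩
    ∑[ t < n ] (+ (m ⊓ (n ∸ toℕ t)))                        ≡⟨ cappedSum-∑ m n ⟩
    + cappedSum m n                                          ∎
    where open ℤP.≤-Reasoning

  topSum-rowSums-total : topSum n (lineList rowSums) ≡ topSum n (lineList (staircase n))
  topSum-rowSums-total = begin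
    topSum n (lineList rowSums)             ≡⟨ topSum-total rowSums ⟩
    ∑[ j < n ] ∑[ t < n ] r j t              ≡⟨ ∑-comm r ⟩
    ∑[ t < n ] ∑[ j < n ] r j t              ≡⟨ sum-cong-≗ colSum ⟩
    sum (staircase n)                        ≡⟨ topSum-total (staircase n) ⟨
    topSum n (lineList (staircase n))       ∎
    where open ≡-Reasoning

  rowSums-⪯-staircase : rowSums ⪯ staircase n
  rowSums-⪯-staircase = top-≤ , topSum-rowSums-total
    where
    top-≤ : ∀ (k : Fin n) → topSum (suc (toℕ k)) (lineList rowSums) ≤ topSum (suc (toℕ k)) (lineList (staircase n))
    top-≤ k = ℤP.≤-trans (topSum-rowSums-≤ (suc (toℕ k))) (ℤP.≤-reflexive (sym (topSum-staircase (suc (toℕ k)) n)))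

-- No sign condition on the entries: alternation of the nonzero entries of every
-- line already forces them to be ±1 (the field IsASHM.entries is never used).
record IsASM {n} (B : Fin n → Fin n → ℤ) : Set where
  field
    rows : ∀ j → AltLine (B j)
    cols : ∀ k → AltLine (λ j → B j k)

weightedRowSums : ∀ {n} → (Fin n → Fin n → ℤ) → Fin n → ℤ
weightedRowSums {n} B j = sumℤ (map (λ k → + suc (toℕ k) * B j k) (allFin n))

ASM-weightedRowSums-⪯-staircase : ∀ {n} {B : Fin n → Fin n → ℤ} → IsASM B → weightedRowSums B ⪯ staircase n
ASM-weightedRowSums-⪯-staircase {n} {B} asm =
  ⪯-respˡ-≗ weighted≡suffix (rowSums-⪯-staircase r (λ j t → AltLine-suffixSum-bit (rows j) (toℕ t)) colSum)
  where
  open IsASM asm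
  r : Fin n → Fin n → ℤ
  r j t = suffixSum (toℕ t) (B j)

  weighted≡suffix : ∀ j → weightedRowSums B j ≡ sum (r j)
  weighted≡suffix j = trans (sumℤ-lineList (λ k → + suc (toℕ k) * B j k)) (weightedSum≡∑suffixSum (B j))

  colSum : ∀ t → ∑[ j < n ] r j t ≡ + (n ∸ toℕ t)
  colSum t = begin
    ∑[ j < n ] suffixSum (toℕ t) (B j)              ≡⟨ suffixSum-∑ (toℕ t) B ⟨
    suffixSum (toℕ t) (λ k → ∑[ j < n ] B j k)      ≡⟨ suffixSum-cong (toℕ t) (λ k → AltLine-sum {a = λ j → B j k} (cols k)) ⟩
    suffixSum (toℕ t) (λ _ → + 1)                   ≡⟨ suffixSum-ones (toℕ t) ⟩
    + (n ∸ toℕ t)                                   ∎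
    where open ≡-Reasoning

corollary4p1 : (n : ℕ) (A : Hyper n) → IsASHM A →
    (∀ (i : Fin n) → (λ j → ASHL A i j) ⪯ staircase n)
    × (∀ (j : Fin n) → (λ i → ASHL A i j) ⪯ staircase n)
corollary4p1 n A ashm =
  (λ i → ASM-weightedRowSums-⪯-staircase record { rows = line-k i ; cols = line-j i }) ,
  (λ j → ASM-weightedRowSums-⪯-staircase record { rows = λ i → line-k i j ; cols = line-i j })
  where open IsASHM ashm
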